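{- Let $r \geq 3$ and $2 \leq q \leq \binom{r}{2}$ be integers, and let $a, b$ be nonnegative integers with $\binom{r}{2} = aq + b$ and $0 \leq b < q$. If $b = 0$ or $r + b \geq q$, then there are infinitely many integers $n$ divisible by $r$ for which there exist an $n$-vertex graph $G$ with minimum degree $\delta(G) = \frac{r}{r+1} n$ and an edge coloring $f: E(G) \to [q]$ such that every $K_r$-tiling of $G$ has discrepancy $0$ with respect to $f$.
   Context: A $K_r$-tiling of $G$ is a collection of vertex-disjoint copies of $K_r$ in $G$ whose vertex sets partition $V(G)$. The discrepancy of a $K_r$-tiling $\mathcal{T}$ with respect to $f$ is the largest $t$ such that some color $c \in [q]$ appears on at least $\frac{e(\mathcal{T})+t}{q}$ of the edges of the copies in $\mathcal{T}$, where $e(\mathcal{T})$ is the total number of such edges. -}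

module Defs where

open import Data.Nat using (ℕ; zero; suc; _+_; _*_; _≤_; _<_; _⊔_)
open import Data.Bool using (Bool; true; false; if_then_else_)
open import Data.Fin using (Fin; toℕ) renaming (zero to fzero; suc to fsuc)
open import Data.Fin.Properties using () renaming (_≟_ to _≟F_)
open import Data.Integer using (ℤ; +_; _-_)
open import Data.Product using (Σ; _×_; _,_; ∃)
open import Relation.Nullary using (¬_; yes; no)
open import Relation.Binary.PropositionalEquality using (_≡_)

sumFin : (k : ℕ) → (Fin k → ℕ) → ℕ
sumFin zero    f = 0
sumFin (suc k) f = f fzero + sumFin k (λ i → f (fsuc i))

maxFin : (k : ℕ) → (Fin k → ℕ) → ℕ
maxFin zero    f = 0
maxFin (suc k) f = f fzero ⊔ maxFin k (λ i → f (fsuc i))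

record Graph (n : ℕ) : Set where
  field
    adj     : Fin n → Fin n → Bool
    adj-sym : ∀ u v → adj u v ≡ adj v u
    adj-irr : ∀ v → adj v v ≡ false
open Graph public

indicator : Bool → ℕ
indicator true  = 1
indicator false = 0

degree : ∀ {n} → Graph n → Fin n → ℕ
degree {n} G v = sumFin n (λ u → indicator (adj G v u))

MinDegree : ∀ {n} → Graph n → ℕ → Set
MinDegree {n} G d = (∃ λ v → degree G v ≡ d) × (∀ v → d ≤ degree G v)

-- An edge colouring f : E(G) → [q], given as a symmetric function on vertex
-- pairs; only its values on edges of G are ever used.
record EdgeColouring {n : ℕ} (G : Graph n) (q : ℕ) : Set where
  field
    col     : Fin n → Fin n → Fin q
    col-sym : ∀ u v → col u v ≡ col v u
open EdgeColouring public

-- A K_r-tiling: m copies of K_r, copy i having vertices σ i 0, …, σ i (r-1);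
-- the map (i , a) ↦ σ i a is a bijection Fin m × Fin r → V(G) (so the vertex
-- sets partition V(G)), and each copy is a clique of G.
record KrTiling {n : ℕ} (G : Graph n) (r : ℕ) : Set where
  field
    m         : ℕ
    σ         : Fin m → Fin r → Fin n
    injective : ∀ i j a b → σ i a ≡ σ j b → (i ≡ j) × (a ≡ b)
    covering  : ∀ v → ∃ λ i → ∃ λ a → σ i a ≡ v
    clique    : ∀ i a b → ¬ (a ≡ b) → adj G (σ i a) (σ i b) ≡ true
open KrTiling public

sumPairs : (r : ℕ) → (Fin r → Fin r → ℕ) → ℕ
sumPairs r g = sumFin r (λ a → sumFin r (λ b → if (toℕ a Data.Nat.<ᵇ toℕ b) then g a b else 0))

eT : ∀ {n r} {G : Graph n} → KrTiling G r → ℕ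
eT {r = r} T = sumFin (m T) (λ i → sumPairs r (λ a b → 1))

colourCount : ∀ {n r q} {G : Graph n} → EdgeColouring G q → KrTiling G r → Fin q → ℕ
colourCount {r = r} f T c =
  sumFin (m T) (λ i → sumPairs r (λ a b →
    indicator (isYes (col f (σ T i a) (σ T i b) ≟F c))))
  where
    isYes : ∀ {P : Set} → Relation.Nullary.Dec P → Bool
    isYes (yes _) = true
    isYes (no _)  = false

-- discrepancy of T w.r.t. f: the largest integer t such that some colour c
-- has colourCount c ≥ (e(T) + t)/q, i.e. t = max_c (q · colourCount c) − e(T).
discrepancy : ∀ {n r q} {G : Graph n} → EdgeColouring G q → KrTiling G r → ℤ
discrepancy {q = q} f T = + maxFin q (λ c → q * colourCount f T c) - + eT T

{-# OPTIONS --safe #-}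
module Submission where

-- Take the complete (r+1)-partite graph with parts V₀, …, V_r of equal size s = t·r·q.
-- An edge between V_i and V_j (i, j ≥ 1) gets the colour of {i, j} in a colouring of K_r
-- whose classes have sizes T_c ∈ {⌊E/q⌋, ⌈E/q⌉}, E = r C 2 (pair index mod q); an edge
-- at V₀ gets the colour of its endpoint in V₀, where colour c is used on t·(E + r − q·T_c)
-- vertices, a nonnegative number because b = 0 or r + b ≥ q. A copy of K_r meets every
-- part but one, and for each colour c its number of c-edges plus T_c equals the sum over
-- its vertices v of (r − 1)·[v ∈ V₀ has colour c] plus the degree of the part of v in the
-- colour-c graph on the parts. Summing over a tiling, every colour occurs exactly
-- (r − 1)·t·(E + r) times, so the discrepancy is 0.

open import Defs
open import Algebra.Properties.CommutativeSemigroup using (interchange)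
open import Data.Bool using (Bool; true; false; not; if_then_else_)
open import Data.Fin using (Fin; toℕ; fromℕ<; punchIn; punchOut; _↑ˡ_; _↑ʳ_; splitAt; remQuot; combine)
  renaming (zero to fzero; suc to fsuc)
open import Data.Fin.Permutation using (Permutation; _⟨$⟩ʳ_; ↔⇒≡)
open import Data.Fin.Properties
  using (_≟_; any?; ¬∀⟶∃¬; injective⇒≤; punchIn-punchOut; punchOut-injective; remQuot-combine;
         splitAt-↑ˡ; splitAt-↑ʳ; fromℕ<-cong; fromℕ<-toℕ; toℕ<n; *↔×)
  renaming (suc-injective to fsuc-injective)
import Data.Integer as ℤ
open import Data.Integer.Properties using (i≡j⇒i-j≡0)
open import Data.Nat using (ℕ; zero; suc; _+_; _*_; _∸_; _≤_; _<_; _≥_; _⊔_; z≤n; s≤s; z<s; s<s; NonZero)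
open import Data.Nat.Combinatorics using (_C_; nC1≡n; nCk+nC[k+1]≡[n+1]C[k+1])
open import Data.Nat.Divisibility using (_∣_; divides)
open import Data.Nat.DivMod using (_mod_; _%_; [m+n]%n≡m%n; m<n⇒m%n≡m)
open import Data.Nat.Properties hiding (_≟_)
open import Data.Nat.Tactic.RingSolver using (solve-∀)
open import Data.Product using (Σ; _×_; _,_; ∃; proj₁; proj₂; uncurry)
open import Data.Sum using (_⊎_; [_,_]′)
open import Data.Vec.Functional using (_∷_)
open import Function using (_∘_; _↔_; mk↔ₛ′; Injective)
open import Function.Construct.Composition using (_↔-∘_)
open import Relation.Binary.PropositionalEquality
open import Relation.Nullary using (¬_; yes; no; does; contradiction)
open import Relation.Nullary.Decidable using (dec-true; dec-false)

open import Algebra.Properties.Semiring.Sum +-*-semiring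
  using (sum; ∑-distrib-+; *-distribˡ-sum; sum-remove; sum-permute)

sumFin≡sum : ∀ {k} (f : Fin k → ℕ) → sumFin k f ≡ sum f
sumFin≡sum {zero}  f = refl
sumFin≡sum {suc k} f = cong (f fzero +_) (sumFin≡sum (f ∘ fsuc))

sumFin-cong : ∀ k {f g : Fin k → ℕ} → (∀ i → f i ≡ g i) → sumFin k f ≡ sumFin k g
sumFin-cong zero    e = refl
sumFin-cong (suc k) e = cong₂ _+_ (e fzero) (sumFin-cong k (e ∘ fsuc))

sumFin-const : ∀ k c → sumFin k (λ _ → c) ≡ k * c
sumFin-const zero    c = refl
sumFin-const (suc k) c = cong (c +_) (sumFin-const k c)

sumFin-zero : ∀ k → sumFin k (λ _ → 0) ≡ 0
sumFin-zero k = trans (sumFin-const k 0) (*-zeroʳ k)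

sumFin-+ : ∀ k (f g : Fin k → ℕ) → sumFin k (λ i → f i + g i) ≡ sumFin k f + sumFin k g
sumFin-+ k f g = begin
  sumFin k (λ i → f i + g i) ≡⟨ sumFin≡sum (λ i → f i + g i) ⟩
  sum (λ i → f i + g i)      ≡⟨ ∑-distrib-+ f g ⟩
  sum f + sum g              ≡⟨ cong₂ _+_ (sumFin≡sum f) (sumFin≡sum g) ⟨
  sumFin k f + sumFin k g    ∎
  where open ≡-Reasoning

sumFin-*ˡ : ∀ k c (f : Fin k → ℕ) → sumFin k (λ i → c * f i) ≡ c * sumFin k f
sumFin-*ˡ k c f = begin
  sumFin k (λ i → c * f i) ≡⟨ sumFin≡sum (λ i → c * f i) ⟩
  sum (λ i → c * f i)      ≡⟨ *-distribˡ-sum c f ⟨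
  c * sum f                ≡⟨ cong (c *_) (sumFin≡sum f) ⟨
  c * sumFin k f           ∎
  where open ≡-Reasoning

sumFin-comm : ∀ k l (f : Fin k → Fin l → ℕ) →
  sumFin k (λ i → sumFin l (f i)) ≡ sumFin l (λ j → sumFin k (λ i → f i j))
sumFin-comm zero    l f = sym (sumFin-zero l)
sumFin-comm (suc k) l f = begin
  sumFin l (f fzero) + sumFin k (λ i → sumFin l (f (fsuc i)))
    ≡⟨ cong (sumFin l (f fzero) +_) (sumFin-comm k l (f ∘ fsuc)) ⟩
  sumFin l (f fzero) + sumFin l (λ j → sumFin k (λ i → f (fsuc i) j))
    ≡⟨ sumFin-+ l (f fzero) _ ⟨
  sumFin l (λ j → f fzero j + sumFin k (λ i → f (fsuc i) j)) ∎
  where open ≡-Reasoning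

sumFin-remove : ∀ k (j : Fin (suc k)) (f : Fin (suc k) → ℕ) →
  sumFin (suc k) f ≡ f j + sumFin k (f ∘ punchIn j)
sumFin-remove k j f = begin
  sumFin (suc k) f               ≡⟨ sumFin≡sum f ⟩
  sum f                          ≡⟨ sum-remove {i = j} f ⟩
  f j + sum (f ∘ punchIn j)      ≡⟨ cong (f j +_) (sumFin≡sum (f ∘ punchIn j)) ⟨
  f j + sumFin k (f ∘ punchIn j) ∎
  where open ≡-Reasoning

sumFin-↑ : ∀ A B (f : Fin (A + B) → ℕ) →
  sumFin (A + B) f ≡ sumFin A (λ i → f (i ↑ˡ B)) + sumFin B (λ j → f (A ↑ʳ j))
sumFin-↑ zero    B f = refl
sumFin-↑ (suc A) B f = trans (cong (f fzero +_) (sumFin-↑ A B (f ∘ fsuc))) (sym (+-assoc (f fzero) _ _))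

sumFin-combine : ∀ A B (f : Fin (A * B) → ℕ) →
  sumFin (A * B) f ≡ sumFin A (λ i → sumFin B (λ j → f (combine i j)))
sumFin-combine zero    B f = refl
sumFin-combine (suc A) B f =
  trans (sumFin-↑ B (A * B) f) (cong (sumFin B (λ j → f (j ↑ˡ A * B)) +_) (sumFin-combine A B (λ y → f (B ↑ʳ y))))

sumFin-remQuot : ∀ A B (h : Fin A → Fin B → ℕ) →
  sumFin (A * B) (λ v → h (proj₁ (remQuot {A} B v)) (proj₂ (remQuot {A} B v))) ≡ sumFin A (λ i → sumFin B (h i))
sumFin-remQuot A B h = trans (sumFin-combine A B (λ v → h (proj₁ (remQuot {A} B v)) (proj₂ (remQuot {A} B v))))
  (sumFin-cong A (λ i → sumFin-cong B (λ j → cong (uncurry h) (remQuot-combine {A} {B} i j))))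

sumFin-injective : ∀ k (π : Fin k → Fin k) → Injective _≡_ _≡_ π → (f : Fin k → ℕ) →
  sumFin k (f ∘ π) ≡ sumFin k f
sumFin-injective zero    π π-inj f = refl
sumFin-injective (suc k) π π-inj f = begin
  f j + sumFin k (f ∘ π ∘ fsuc)         ≡⟨ cong (f j +_) (sumFin-cong k (λ y → cong f (punchIn-punchOut (j≢ y)))) ⟨
  f j + sumFin k (f ∘ punchIn j ∘ π′)   ≡⟨ cong (f j +_) (sumFin-injective k π′ π′-inj (f ∘ punchIn j)) ⟩
  f j + sumFin k (f ∘ punchIn j)        ≡⟨ sumFin-remove k j f ⟨
  sumFin (suc k) f                      ∎
  where
  open ≡-Reasoning
  j : Fin (suc k)
  j = π fzero
  j≢ : ∀ y → j ≢ π (fsuc y)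
  j≢ y e with () ← π-inj e
  π′ : Fin k → Fin k
  π′ y = punchOut (j≢ y)
  π′-inj : Injective _≡_ _≡_ π′
  π′-inj e = fsuc-injective (π-inj (punchOut-injective (j≢ _) (j≢ _) e))

injection-misses-one : ∀ r (τ : Fin r → Fin (suc r)) → Injective _≡_ _≡_ τ →
  ∃ λ j → ∀ f → sumFin (suc r) f ≡ f j + sumFin r (f ∘ τ)
injection-misses-one r τ τ-inj = j , λ f → sym (sumFin-injective (suc r) (j ∷ τ) extension-inj f)
  where
  Hit : Fin (suc r) → Set
  Hit p = ∃ λ a → τ a ≡ p
  not-onto : ¬ (∀ p → Hit p)
  not-onto onto = 1+n≰n (injective⇒≤ {f = proj₁ ∘ onto} λ {p} {p′} e →
    trans (sym (proj₂ (onto p))) (trans (cong τ e) (proj₂ (onto p′))))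
  missed : ∃ λ j → ¬ Hit j
  missed = ¬∀⟶∃¬ (suc r) Hit (λ p → any? (λ a → τ a ≟ p)) not-onto
  j : Fin (suc r)
  j = proj₁ missed
  extension-inj : Injective _≡_ _≡_ (j ∷ τ)
  extension-inj {fzero}  {fzero}  e = refl
  extension-inj {fzero}  {fsuc b} e = contradiction (b , sym e) (proj₂ missed)
  extension-inj {fsuc a} {fzero}  e = contradiction (a , e) (proj₂ missed)
  extension-inj {fsuc a} {fsuc b} e = cong fsuc (τ-inj e)

maxFin-const : ∀ k {f : Fin (suc k) → ℕ} {v} → (∀ c → f c ≡ v) → maxFin (suc k) f ≡ v
maxFin-const zero    f≡v = trans (⊔-identityʳ _) (f≡v fzero)
maxFin-const (suc k) f≡v = trans (cong₂ _⊔_ (f≡v fzero) (maxFin-const k (f≡v ∘ fsuc))) (⊔-idem _)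

sumPairs-cong : ∀ r {g h : Fin r → Fin r → ℕ} → (∀ a b → toℕ a < toℕ b → g a b ≡ h a b) →
  sumPairs r g ≡ sumPairs r h
sumPairs-cong zero    e = refl
sumPairs-cong (suc r) e = cong₂ _+_
  (sumFin-cong r (λ b → e fzero (fsuc b) z<s))
  (sumPairs-cong r (λ a b a<b → e (fsuc a) (fsuc b) (s<s a<b)))

sumPairs-+ : ∀ r (g h : Fin r → Fin r → ℕ) →
  sumPairs r (λ a b → g a b + h a b) ≡ sumPairs r g + sumPairs r h
sumPairs-+ zero    g h = refl
sumPairs-+ (suc r) g h = trans
  (cong₂ _+_ (sumFin-+ r (g fzero ∘ fsuc) (h fzero ∘ fsuc))
             (sumPairs-+ r (λ a b → g (fsuc a) (fsuc b)) (λ a b → h (fsuc a) (fsuc b))))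
  (interchange +-commutativeSemigroup (sumFin r (g fzero ∘ fsuc)) (sumFin r (h fzero ∘ fsuc)) _ _)

sumPairs-endpoints : ∀ r (φ : Fin (suc r) → ℕ) → sumPairs (suc r) (λ a b → φ a + φ b) ≡ r * sumFin (suc r) φ
sumPairs-endpoints zero    φ = refl
sumPairs-endpoints (suc r) φ = begin
  sumFin (suc r) (λ b → φ fzero + φ (fsuc b)) + sumPairs (suc r) (λ a b → φ (fsuc a) + φ (fsuc b))
    ≡⟨ cong₂ _+_ (sumFin-+ (suc r) (λ _ → φ fzero) (φ ∘ fsuc)) (sumPairs-endpoints r (φ ∘ fsuc)) ⟩
  sumFin (suc r) (λ _ → φ fzero) + Σ′ + r * Σ′
    ≡⟨ cong (λ x → x + Σ′ + r * Σ′) (sumFin-const (suc r) (φ fzero)) ⟩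
  suc r * φ fzero + Σ′ + r * Σ′
    ≡⟨ regroup r (φ fzero) Σ′ ⟩
  suc r * (φ fzero + Σ′) ∎
  where
  open ≡-Reasoning
  regroup : ∀ r x y → suc r * x + y + r * y ≡ suc r * (x + y)
  regroup = solve-∀
  Σ′ : ℕ
  Σ′ = sumFin (suc r) (φ ∘ fsuc)

sumPairs-double : ∀ r (g : Fin r → Fin r → ℕ) → (∀ a b → g a b ≡ g b a) → (∀ a → g a a ≡ 0) →
  2 * sumPairs r g ≡ sumFin r (λ a → sumFin r (g a))
sumPairs-double zero    g g-sym g-diag = refl
sumPairs-double (suc r) g g-sym g-diag = begin
  2 * (row + sumPairs r g′)
    ≡⟨ regroup row (sumPairs r g′) ⟩
  row + row + 2 * sumPairs r g′
    ≡⟨ cong₂ (λ x y → row + x + y) (sumFin-cong r (λ b → g-sym fzero (fsuc b)))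
             (sumPairs-double r g′ (λ a b → g-sym (fsuc a) (fsuc b)) (g-diag ∘ fsuc)) ⟩
  row + column + sumFin r (λ a → sumFin r (g′ a))
    ≡⟨ +-assoc row column _ ⟩
  row + (column + sumFin r (λ a → sumFin r (g′ a)))
    ≡⟨ cong₂ _+_ (cong (_+ row) (g-diag fzero)) (sumFin-+ r (λ a → g (fsuc a) fzero) _) ⟨
  g fzero fzero + row + sumFin r (λ a → g (fsuc a) fzero + sumFin r (g′ a)) ∎
  where
  open ≡-Reasoning
  regroup : ∀ x y → 2 * (x + y) ≡ x + x + 2 * y
  regroup = solve-∀
  g′ : Fin r → Fin r → ℕ
  g′ a b = g (fsuc a) (fsuc b)
  row column : ℕ
  row = sumFin r (λ b → g fzero (fsuc b))
  column = sumFin r (λ a → g (fsuc a) fzero)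

-- If τ misses only j, the degrees over the image of τ count each inner pair twice and each
-- pair at j once, and so does the inner sum plus the total, as Y j j = 0.
sumPairs-all-but-one : ∀ r (Y : Fin (suc r) → Fin (suc r) → ℕ) →
  (∀ p p′ → Y p p′ ≡ Y p′ p) → (∀ p → Y p p ≡ 0) →
  (τ : Fin r → Fin (suc r)) → Injective _≡_ _≡_ τ →
  sumPairs r (λ a b → Y (τ a) (τ b)) + sumPairs (suc r) Y ≡ sumFin r (λ a → sumFin (suc r) (Y (τ a)))
sumPairs-all-but-one r Y Y-sym Y-diag τ τ-inj = *-cancelˡ-≡ (inner + total) D 2 (begin
  2 * (inner + total)           ≡⟨ *-distribˡ-+ 2 inner total ⟩
  2 * inner + 2 * total         ≡⟨ cong₂ _+_ inner-double total-double ⟩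
  ΣΣ + (deg j + D)              ≡⟨ regroup ΣΣ (deg j) D ⟩
  deg j + ΣΣ + D                ≡⟨ cong (_+ D) D-split ⟨
  D + D                         ≡⟨ cong (D +_) (+-identityʳ D) ⟨
  2 * D                         ∎)
  where
  open ≡-Reasoning
  j : Fin (suc r)
  j = proj₁ (injection-misses-one r τ τ-inj)
  split : ∀ f → sumFin (suc r) f ≡ f j + sumFin r (f ∘ τ)
  split = proj₂ (injection-misses-one r τ τ-inj)
  deg : Fin (suc r) → ℕ
  deg p = sumFin (suc r) (Y p)
  inner total D ΣΣ : ℕ
  inner = sumPairs r (λ a b → Y (τ a) (τ b))
  total = sumPairs (suc r) Y
  D     = sumFin r (deg ∘ τ)
  ΣΣ    = sumFin r (λ a → sumFin r (λ b → Y (τ a) (τ b)))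
  inner-double : 2 * inner ≡ ΣΣ
  inner-double = sumPairs-double r (λ a b → Y (τ a) (τ b)) (λ a b → Y-sym (τ a) (τ b)) (Y-diag ∘ τ)
  total-double : 2 * total ≡ deg j + D
  total-double = trans (sumPairs-double (suc r) Y Y-sym Y-diag) (split deg)
  deg-missed : sumFin r (λ a → Y (τ a) j) ≡ deg j
  deg-missed = begin
    sumFin r (λ a → Y (τ a) j)       ≡⟨ sumFin-cong r (λ a → Y-sym (τ a) j) ⟩
    sumFin r (Y j ∘ τ)               ≡⟨ cong (_+ sumFin r (Y j ∘ τ)) (Y-diag j) ⟨
    Y j j + sumFin r (Y j ∘ τ)       ≡⟨ split (Y j) ⟨
    deg j                            ∎
  D-split : D ≡ deg j + ΣΣ
  D-split = begin
    D                                                       ≡⟨ sumFin-cong r (split ∘ Y ∘ τ) ⟩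
    sumFin r (λ a → Y (τ a) j + sumFin r (Y (τ a) ∘ τ))     ≡⟨ sumFin-+ r (λ a → Y (τ a) j) _ ⟩
    sumFin r (λ a → Y (τ a) j) + ΣΣ                         ≡⟨ cong (_+ ΣΣ) deg-missed ⟩
    deg j + ΣΣ                                              ∎
  regroup : ∀ x y z → x + (y + z) ≡ y + x + z
  regroup = solve-∀

choose2 : ℕ → ℕ
choose2 zero    = 0
choose2 (suc r) = r + choose2 r

choose2≡C2 : ∀ r → choose2 r ≡ r C 2
choose2≡C2 zero    = refl
choose2≡C2 (suc r) = trans (cong₂ _+_ (sym (nC1≡n r)) (choose2≡C2 r)) (nCk+nC[k+1]≡[n+1]C[k+1] r 1)

choose2-double : ∀ r → 2 * choose2 (suc r) ≡ suc r * r
choose2-double zero    = refl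
choose2-double (suc r) = begin
  2 * (suc r + choose2 (suc r))      ≡⟨ *-distribˡ-+ 2 (suc r) _ ⟩
  2 * suc r + 2 * choose2 (suc r)    ≡⟨ cong (2 * suc r +_) (choose2-double r) ⟩
  2 * suc r + suc r * r              ≡⟨ regroup r ⟩
  suc (suc r) * suc r                ∎
  where
  open ≡-Reasoning
  regroup : ∀ r → 2 * suc r + suc r * r ≡ suc (suc r) * suc r
  regroup = solve-∀

sumPairs-one : ∀ r → sumPairs r (λ _ _ → 1) ≡ choose2 r
sumPairs-one zero    = refl
sumPairs-one (suc r) = cong₂ _+_ (trans (sumFin-const r 1) (*-identityʳ r)) (sumPairs-one r)

-- Numbers the pairs a < b lexicographically by 0, …, choose2 r − 1 (symmetrically for
-- a > b); the value 0 on the diagonal is arbitrary.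
pairIndex : ∀ {r} → Fin r → Fin r → ℕ
pairIndex {suc r} fzero    fzero    = 0
pairIndex {suc r} fzero    (fsuc b) = toℕ b
pairIndex {suc r} (fsuc a) fzero    = toℕ a
pairIndex {suc r} (fsuc a) (fsuc b) = r + pairIndex a b

pairIndex-sym : ∀ {r} (a b : Fin r) → pairIndex a b ≡ pairIndex b a
pairIndex-sym         fzero    fzero    = refl
pairIndex-sym         fzero    (fsuc b) = refl
pairIndex-sym         (fsuc a) fzero    = refl
pairIndex-sym {suc r} (fsuc a) (fsuc b) = cong (r +_) (pairIndex-sym a b)

rangeSum : ℕ → (ℕ → ℕ) → ℕ
rangeSum L F = sumFin L (F ∘ toℕ)

rangeSum-+ : ∀ A B (F : ℕ → ℕ) → rangeSum (A + B) F ≡ rangeSum A F + rangeSum B (λ e → F (A + e))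
rangeSum-+ zero    B F = refl
rangeSum-+ (suc A) B F = trans (cong (F 0 +_) (rangeSum-+ A B (F ∘ suc))) (sym (+-assoc (F 0) _ _))

rangeSum-mono : ∀ {A B} (F : ℕ → ℕ) → A ≤ B → rangeSum A F ≤ rangeSum B F
rangeSum-mono {A} {B} F A≤B = ≤-trans (m≤m+n (rangeSum A F) _)
  (≤-reflexive (trans (sym (rangeSum-+ A (B ∸ A) F)) (cong (λ L → rangeSum L F) (m+[n∸m]≡n A≤B))))

sumPairs-pairIndex : ∀ r (F : ℕ → ℕ) → sumPairs r (λ a b → F (pairIndex a b)) ≡ rangeSum (choose2 r) F
sumPairs-pairIndex zero    F = refl
sumPairs-pairIndex (suc r) F =
  trans (cong (rangeSum r F +_) (sumPairs-pairIndex r (λ e → F (r + e)))) (sym (rangeSum-+ r (choose2 r) F))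

δ : ∀ {k} → Fin k → Fin k → ℕ
δ x y = indicator (does (x ≟ y))

does-≟-sym : ∀ {k} (x y : Fin k) → does (x ≟ y) ≡ does (y ≟ x)
does-≟-sym x y with x ≟ y
... | yes x≡y = sym (dec-true (y ≟ x) (sym x≡y))
... | no  x≢y = sym (dec-false (y ≟ x) (x≢y ∘ sym))

sumFin-δ : ∀ k (c : Fin k) → sumFin k (λ x → δ x c) ≡ 1
sumFin-δ (suc k) fzero    = cong suc (sumFin-zero k)
sumFin-δ (suc k) (fsuc c) = sumFin-δ k c

sumFin-δ′ : ∀ k (x : Fin k) → sumFin k (δ x) ≡ 1
sumFin-δ′ k x = trans (sumFin-cong k (cong indicator ∘ does-≟-sym x)) (sumFin-δ k x)

indicator-not : ∀ b → indicator b + indicator (not b) ≡ 1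
indicator-not true  = refl
indicator-not false = refl

sumFin-≢ : ∀ r (j : Fin (suc r)) → sumFin (suc r) (λ p → indicator (not (does (j ≟ p)))) ≡ r
sumFin-≢ r j = suc-injective (begin
  suc (sumFin (suc r) ≢j)                    ≡⟨ cong (_+ sumFin (suc r) ≢j) (sumFin-δ′ (suc r) j) ⟨
  sumFin (suc r) (δ j) + sumFin (suc r) ≢j   ≡⟨ sumFin-+ (suc r) (δ j) ≢j ⟨
  sumFin (suc r) (λ p → δ j p + ≢j p)        ≡⟨ sumFin-cong (suc r) (indicator-not ∘ does ∘ (j ≟_)) ⟩
  sumFin (suc r) (λ _ → 1)                   ≡⟨ sumFin-const (suc r) 1 ⟩
  suc r * 1                                  ≡⟨ *-identityʳ (suc r) ⟩
  suc r                                      ∎)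
  where
  open ≡-Reasoning
  ≢j : Fin (suc r) → ℕ
  ≢j p = indicator (not (does (j ≟ p)))

module _ (q : ℕ) .{{_ : NonZero q}} where

  residueCount : ℕ → Fin q → ℕ
  residueCount L c = rangeSum L (λ e → δ (e mod q) c)

  toℕ-mod : (x : Fin q) → toℕ x mod q ≡ x
  toℕ-mod x = trans (fromℕ<-cong _ _ (m<n⇒m%n≡m (toℕ<n x)) _ (toℕ<n x)) (fromℕ<-toℕ x (toℕ<n x))

  mod-periodic : ∀ e → (q + e) mod q ≡ e mod q
  mod-periodic e = fromℕ<-cong _ _ (trans (cong (_% q) (+-comm q e)) ([m+n]%n≡m%n e q)) _ _

  residueCount-q : ∀ c → residueCount q c ≡ 1
  residueCount-q c = trans (sumFin-cong q (λ x → cong (λ y → δ y c) (toℕ-mod x))) (sumFin-δ q c)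

  residueCount-period : ∀ a b c → residueCount (a * q + b) c ≡ a + residueCount b c
  residueCount-period zero    b c = refl
  residueCount-period (suc a) b c = begin
    residueCount (q + a * q + b) c
      ≡⟨ cong (λ L → residueCount L c) (+-assoc q (a * q) b) ⟩
    residueCount (q + (a * q + b)) c
      ≡⟨ rangeSum-+ q (a * q + b) (λ e → δ (e mod q) c) ⟩
    residueCount q c + rangeSum (a * q + b) (λ e → δ ((q + e) mod q) c)
      ≡⟨ cong₂ _+_ (residueCount-q c) (sumFin-cong (a * q + b) (λ e → cong (λ y → δ y c) (mod-periodic (toℕ e)))) ⟩
    1 + residueCount (a * q + b) c
      ≡⟨ cong suc (residueCount-period a b c) ⟩
    suc (a + residueCount b c) ∎
    where open ≡-Reasoning

  residueCount-≤1 : ∀ {b} c → b ≤ q → residueCount b c ≤ 1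
  residueCount-≤1 c b≤q = ≤-trans (rangeSum-mono (λ e → δ (e mod q) c) b≤q) (≤-reflexive (residueCount-q c))

  sumFin-residueCount : ∀ L → sumFin q (residueCount L) ≡ L
  sumFin-residueCount L = begin
    sumFin q (residueCount L)                      ≡⟨ sumFin-comm q L (λ c e → δ (toℕ e mod q) c) ⟩
    sumFin L (λ e → sumFin q (δ (toℕ e mod q)))    ≡⟨ sumFin-cong L (λ e → sumFin-δ′ q (toℕ e mod q)) ⟩
    sumFin L (λ _ → 1)                             ≡⟨ sumFin-const L 1 ⟩
    L * 1                                          ≡⟨ *-identityʳ L ⟩
    L                                              ∎
    where open ≡-Reasoning

blockOf : ∀ {k} (sizes : Fin k → ℕ) → Fin (sumFin k sizes) → Fin k
blockOf {suc k} sizes y = [ (λ _ → fzero) , fsuc ∘ blockOf (sizes ∘ fsuc) ]′ (splitAt (sizes fzero) y)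

blockOf-count : ∀ k (sizes : Fin k → ℕ) c → sumFin (sumFin k sizes) (λ y → δ (blockOf sizes y) c) ≡ sizes c
blockOf-count (suc k) sizes c = begin
  sumFin (sizes fzero + S) (λ y → δ (blockOf sizes y) c)
    ≡⟨ sumFin-↑ (sizes fzero) S (λ y → δ (blockOf sizes y) c) ⟩
  sumFin (sizes fzero) (λ i → δ (blockOf sizes (i ↑ˡ S)) c) + sumFin S (λ j → δ (blockOf sizes (sizes fzero ↑ʳ j)) c)
    ≡⟨ cong₂ _+_ (sumFin-cong (sizes fzero) (λ i → cong (λ x → δ x c) (first-block i)))
                 (sumFin-cong S (λ j → cong (λ x → δ x c) (later-block j))) ⟩
  sumFin (sizes fzero) (λ _ → δ fzero c) + sumFin S (λ j → δ (fsuc (blockOf (sizes ∘ fsuc) j)) c)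
    ≡⟨ count c ⟩
  sizes c ∎
  where
  open ≡-Reasoning
  S : ℕ
  S = sumFin k (sizes ∘ fsuc)
  first-block : ∀ i → blockOf sizes (i ↑ˡ S) ≡ fzero
  first-block i rewrite splitAt-↑ˡ (sizes fzero) i S = refl
  later-block : ∀ j → blockOf sizes (sizes fzero ↑ʳ j) ≡ fsuc (blockOf (sizes ∘ fsuc) j)
  later-block j rewrite splitAt-↑ʳ (sizes fzero) S j = refl
  count : ∀ c → sumFin (sizes fzero) (λ _ → δ fzero c) + sumFin S (λ j → δ (fsuc (blockOf (sizes ∘ fsuc) j)) c) ≡ sizes c
  count fzero    = trans (cong₂ _+_ (sumFin-const (sizes fzero) 1) (sumFin-zero S))
                         (trans (+-identityʳ _) (*-identityʳ (sizes fzero)))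
  count (fsuc c) = trans (cong (_+ sumFin S (λ j → δ (blockOf (sizes ∘ fsuc) j) c)) (sumFin-zero (sizes fzero)))
                         (blockOf-count k (sizes ∘ fsuc) c)

module _ {n r : ℕ} {G : Graph n} (T : KrTiling G r) where

  tiling↔ : (Fin (m T) × Fin r) ↔ Fin n
  tiling↔ = mk↔ₛ′ (uncurry (σ T)) copyOf (λ v → proj₂ (proj₂ (covering T v))) copyOf-σ
    where
    copyOf : Fin n → Fin (m T) × Fin r
    copyOf v = proj₁ (covering T v) , proj₁ (proj₂ (covering T v))
    copyOf-σ : ∀ p → copyOf (uncurry (σ T) p) ≡ p
    copyOf-σ (i , a) with i′ , a′ , e ← covering T (σ T i a) with refl , refl ← injective T i′ i a′ a e = refl

  tilingPermutation : Permutation (m T * r) n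
  tilingPermutation = tiling↔ ↔-∘ *↔×

  tiling-size : m T * r ≡ n
  tiling-size = ↔⇒≡ tilingPermutation

  sumFin-tiling : (g : Fin n → ℕ) → sumFin n g ≡ sumFin (m T) (λ i → sumFin r (λ a → g (σ T i a)))
  sumFin-tiling g = begin
    sumFin n g                                         ≡⟨ sumFin≡sum g ⟩
    sum g                                              ≡⟨ sum-permute g tilingPermutation ⟩
    sum (g ∘ π)                                        ≡⟨ sumFin≡sum (g ∘ π) ⟨
    sumFin (m T * r) (g ∘ π)                           ≡⟨ sumFin-remQuot (m T) r (λ i a → g (σ T i a)) ⟩
    sumFin (m T) (λ i → sumFin r (λ a → g (σ T i a)))  ∎
    where
    open ≡-Reasoning
    π : Fin (m T * r) → Fin n
    π = tilingPermutation ⟨$⟩ʳ_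

edgeSum : ∀ {n r} {G : Graph n} → KrTiling G r → (Fin n → Fin n → ℕ) → ℕ
edgeSum {r = r} T g = sumFin (m T) (λ i → sumPairs r (λ a b → g (σ T i a) (σ T i b)))

eT≡copies*choose2 : ∀ {n r} {G : Graph n} (T : KrTiling G r) → eT T ≡ m T * choose2 r
eT≡copies*choose2 {r = r} T = trans (sumFin-cong (m T) (λ _ → sumPairs-one r)) (sumFin-const (m T) (choose2 r))

-- colourCount compares colours with an isYes local to its where block, which cannot be
-- named here. The meta colourTest is solved to it by unification in the last clause, where
-- the first colour of the first copy is a variable; _+_ is abstracted there as well, since
-- Agda does not decompose equations between sums.
mutual
  colourTest : ∀ {n r q} {G : Graph n} → EdgeColouring G q → KrTiling G (2 + r) → Fin q → Fin q → Bool
  colourTest f T c = _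

  colourCount-colourTest : ∀ {n r q} {G : Graph n} (f : EdgeColouring G q) (T : KrTiling G (2 + r)) (c : Fin q) →
    colourCount f T c ≡ edgeSum T (λ u v → indicator (colourTest f T c (col f u v)))
  colourCount-colourTest f T c with m T | σ T
  ... | zero  | _ = refl
  ... | suc _ | s with col f (s fzero fzero) (s fzero (fsuc fzero)) | _+_
  ...   | _ | _ = refl

colourTest-δ : ∀ {n r q} {G : Graph n} (f : EdgeColouring G q) (T : KrTiling G (2 + r)) (c x : Fin q) →
  indicator (colourTest f T c x) ≡ δ x c
colourTest-δ f T c x with x ≟ c
... | yes _ = refl
... | no  _ = refl

colourCount≡edgeSum : ∀ {n r q} {G : Graph n} (f : EdgeColouring G q) (T : KrTiling G (2 + r)) (c : Fin q) →
  colourCount f T c ≡ edgeSum T (λ u v → δ (col f u v) c)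
colourCount≡edgeSum {r = r} f T c = trans (colourCount-colourTest f T c)
  (sumFin-cong (m T) (λ i → sumPairs-cong (2 + r) (λ a b _ → colourTest-δ f T c (col f (σ T i a) (σ T i b)))))

module _ {n k : ℕ} {G : Graph n} (part : Fin n → Fin (2 + k))
         (part-adj : ∀ {u v} → adj G u v ≡ true → part u ≢ part v)
         (Y : Fin (2 + k) → Fin (2 + k) → ℕ) (Y-sym : ∀ p p′ → Y p p′ ≡ Y p′ p) (Y-diag : ∀ p → Y p p ≡ 0)
         (φ : Fin n → ℕ) (g : Fin n → Fin n → ℕ)
         (g-split : ∀ {u v} → adj G u v ≡ true → g u v ≡ φ u + φ v + Y (part u) (part v)) where

  copy-edgeSum : (T : KrTiling G (suc k)) (i : Fin (m T)) →
    sumPairs (suc k) (λ a b → g (σ T i a) (σ T i b)) + sumPairs (2 + k) Y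
      ≡ sumFin (suc k) (λ a → k * φ (σ T i a) + sumFin (2 + k) (Y (part (σ T i a))))
  copy-edgeSum T i = begin
    sumPairs (suc k) (λ a b → g (s a) (s b)) + total
      ≡⟨ cong (_+ total) (sumPairs-cong (suc k) (λ a b a<b → g-split (clique T i a b (<⇒≢ a<b ∘ cong toℕ)))) ⟩
    sumPairs (suc k) (λ a b → φ (s a) + φ (s b) + Y (τ a) (τ b)) + total
      ≡⟨ cong (_+ total) (sumPairs-+ (suc k) (λ a b → φ (s a) + φ (s b)) (λ a b → Y (τ a) (τ b))) ⟩
    sumPairs (suc k) (λ a b → φ (s a) + φ (s b)) + inner + total
      ≡⟨ cong (λ x → x + inner + total) (sumPairs-endpoints k (φ ∘ s)) ⟩
    k * sumFin (suc k) (φ ∘ s) + inner + total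
      ≡⟨ +-assoc (k * sumFin (suc k) (φ ∘ s)) inner total ⟩
    k * sumFin (suc k) (φ ∘ s) + (inner + total)
      ≡⟨ cong₂ _+_ (sym (sumFin-*ˡ (suc k) k (φ ∘ s))) (sumPairs-all-but-one (suc k) Y Y-sym Y-diag τ τ-inj) ⟩
    sumFin (suc k) (λ a → k * φ (s a)) + sumFin (suc k) (λ a → sumFin (2 + k) (Y (τ a)))
      ≡⟨ sumFin-+ (suc k) (λ a → k * φ (s a)) (λ a → sumFin (2 + k) (Y (τ a))) ⟨
    sumFin (suc k) (λ a → k * φ (s a) + sumFin (2 + k) (Y (τ a))) ∎
    where
    open ≡-Reasoning
    s : Fin (suc k) → Fin n
    s = σ T i
    τ : Fin (suc k) → Fin (2 + k)
    τ = part ∘ s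
    τ-inj : Injective _≡_ _≡_ τ
    τ-inj {a} {b} e with a ≟ b
    ... | yes a≡b = a≡b
    ... | no  a≢b = contradiction e (part-adj (clique T i a b a≢b))
    inner total : ℕ
    inner = sumPairs (suc k) (λ a b → Y (τ a) (τ b))
    total = sumPairs (2 + k) Y

  edgeSum-partite : (T : KrTiling G (suc k)) →
    edgeSum T g + m T * sumPairs (2 + k) Y ≡ sumFin n (λ v → k * φ v + sumFin (2 + k) (Y (part v)))
  edgeSum-partite T = begin
    edgeSum T g + m T * total
      ≡⟨ cong (edgeSum T g +_) (sumFin-const (m T) total) ⟨
    edgeSum T g + sumFin (m T) (λ _ → total)
      ≡⟨ sumFin-+ (m T) (λ i → sumPairs (suc k) (λ a b → g (σ T i a) (σ T i b))) (λ _ → total) ⟨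
    sumFin (m T) (λ i → sumPairs (suc k) (λ a b → g (σ T i a) (σ T i b)) + total)
      ≡⟨ sumFin-cong (m T) (copy-edgeSum T) ⟩
    sumFin (m T) (λ i → sumFin (suc k) (weight ∘ σ T i))
      ≡⟨ sumFin-tiling T weight ⟨
    sumFin n weight ∎
    where
    open ≡-Reasoning
    total : ℕ
    total = sumPairs (2 + k) Y
    weight : Fin n → ℕ
    weight v = k * φ v + sumFin (2 + k) (Y (part v))

regular⇒MinDegree : ∀ {n d} {G : Graph n} → (∀ v → degree G v ≡ d) → Fin n → MinDegree G d
regular⇒MinDegree degree≡d v = (v , degree≡d v) , (λ u → ≤-reflexive (sym (degree≡d u)))

module CompleteMultipartite (p s : ℕ) where

  part : Fin (p * s) → Fin p
  part v = proj₁ (remQuot {p} s v)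

  slot : Fin (p * s) → Fin s
  slot v = proj₂ (remQuot {p} s v)

  graph : Graph (p * s)
  graph = record
    { adj     = λ u v → not (does (part u ≟ part v))
    ; adj-sym = λ u v → cong not (does-≟-sym (part u) (part v))
    ; adj-irr = λ v → cong not (dec-true (part v ≟ part v) refl)
    }

  adj⇒part≢ : ∀ {u v} → adj graph u v ≡ true → part u ≢ part v
  adj⇒part≢ {u} {v} adj≡true part≡
    with () ← trans (sym adj≡true) (cong not (dec-true (part u ≟ part v) part≡))

degree-completeMultipartite : ∀ r s (v : Fin (suc r * s)) → degree (CompleteMultipartite.graph (suc r) s) v ≡ r * s
degree-completeMultipartite r s v = begin
  degree graph v                                    ≡⟨ sumFin-remQuot (suc r) s (λ p _ → ≢v p) ⟩
  sumFin (suc r) (λ p → sumFin s (λ _ → ≢v p))      ≡⟨ sumFin-cong (suc r) (sumFin-const s ∘ ≢v) ⟩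
  sumFin (suc r) (λ p → s * ≢v p)                   ≡⟨ sumFin-*ˡ (suc r) s ≢v ⟩
  s * sumFin (suc r) ≢v                             ≡⟨ cong (s *_) (sumFin-≢ r (part v)) ⟩
  s * r                                             ≡⟨ *-comm s r ⟩
  r * s                                             ∎
  where
  open ≡-Reasoning
  open CompleteMultipartite (suc r) s
  ≢v : Fin (suc r) → ℕ
  ≢v p = indicator (not (does (part v ≟ p)))

module MultipartiteColouring (k q₁ s : ℕ) (κ : Fin (suc k) → Fin (suc k) → Fin (suc q₁))
                             (κ-sym : ∀ i j → κ i j ≡ κ j i) (h : Fin s → Fin (suc q₁)) where

  open CompleteMultipartite (2 + k) s public

  -- Pairs within one part are not edges, so their colour is arbitrary.
  partColour : Fin (2 + k) → Fin s → Fin (2 + k) → Fin s → Fin (suc q₁)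
  partColour fzero    x fzero    y = fzero
  partColour fzero    x (fsuc j) y = h x
  partColour (fsuc i) x fzero    y = h y
  partColour (fsuc i) x (fsuc j) y = κ i j

  partColour-sym : ∀ p x p′ y → partColour p x p′ y ≡ partColour p′ y p x
  partColour-sym fzero    x fzero    y = refl
  partColour-sym fzero    x (fsuc j) y = refl
  partColour-sym (fsuc i) x fzero    y = refl
  partColour-sym (fsuc i) x (fsuc j) y = κ-sym i j

  colouring : EdgeColouring graph (suc q₁)
  colouring = record
    { col     = λ u v → partColour (part u) (slot u) (part v) (slot v)
    ; col-sym = λ u v → partColour-sym (part u) (slot u) (part v) (slot v)
    }

  pairCount vertexCount : Fin (suc q₁) → ℕ
  pairCount   c = sumPairs (suc k) (λ i j → δ (κ i j) c)
  vertexCount c = sumFin s (λ x → δ (h x) c)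

  module _ (c : Fin (suc q₁)) where

    Y : Fin (2 + k) → Fin (2 + k) → ℕ
    Y fzero    _        = 0
    Y (fsuc i) fzero    = 0
    Y (fsuc i) (fsuc j) = if does (i ≟ j) then 0 else δ (κ i j) c

    Y-sym : ∀ p p′ → Y p p′ ≡ Y p′ p
    Y-sym fzero    fzero    = refl
    Y-sym fzero    (fsuc j) = refl
    Y-sym (fsuc i) fzero    = refl
    Y-sym (fsuc i) (fsuc j) = cong₂ (λ t x → if t then 0 else δ x c) (does-≟-sym i j) (κ-sym i j)

    Y-diag : ∀ p → Y p p ≡ 0
    Y-diag fzero    = refl
    Y-diag (fsuc i) = cong (λ t → if t then 0 else δ (κ i i) c) (dec-true (i ≟ i) refl)

    sumPairs-Y : sumPairs (2 + k) Y ≡ pairCount c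
    sumPairs-Y = trans (cong (_+ sumPairs (suc k) (λ i j → Y (fsuc i) (fsuc j))) (sumFin-zero (suc k)))
      (sumPairs-cong (suc k) (λ i j i<j →
        cong (λ t → if t then 0 else δ (κ i j) c) (dec-false (i ≟ j) (<⇒≢ i<j ∘ cong toℕ))))

    φ : Fin (2 + k) → Fin s → ℕ
    φ fzero    x = δ (h x) c
    φ (fsuc _) _ = 0

    partColour-split : ∀ p x p′ y → p ≢ p′ → δ (partColour p x p′ y) c ≡ φ p x + φ p′ y + Y p p′
    partColour-split fzero    x fzero    y p≢p′ = contradiction refl p≢p′
    partColour-split fzero    x (fsuc j) y _    = sym (trans (+-identityʳ _) (+-identityʳ _))
    partColour-split (fsuc i) x fzero    y _    = sym (+-identityʳ _)
    partColour-split (fsuc i) x (fsuc j) y p≢p′ =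
      cong (λ t → if t then 0 else δ (κ i j) c) (sym (dec-false (i ≟ j) (p≢p′ ∘ cong fsuc)))

    weight-sum : sumFin ((2 + k) * s) (λ v → k * φ (part v) (slot v) + sumFin (2 + k) (Y (part v)))
               ≡ k * vertexCount c + s * (2 * pairCount c)
    weight-sum = begin
      sumFin ((2 + k) * s) (λ v → k * φ (part v) (slot v) + deg (part v))
        ≡⟨ sumFin-remQuot (2 + k) s (λ p x → k * φ p x + deg p) ⟩
      sumFin (2 + k) (λ p → sumFin s (λ x → k * φ p x + deg p))
        ≡⟨ sumFin-cong (2 + k) (λ p → trans (sumFin-+ s (λ x → k * φ p x) (λ _ → deg p))
                                            (cong₂ _+_ (sumFin-*ˡ s k (φ p)) (sumFin-const s (deg p)))) ⟩
      sumFin (2 + k) (λ p → k * sumFin s (φ p) + s * deg p)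
        ≡⟨ trans (sumFin-+ (2 + k) (λ p → k * sumFin s (φ p)) (λ p → s * deg p))
                 (cong₂ _+_ (sumFin-*ˡ (2 + k) k (λ p → sumFin s (φ p))) (sumFin-*ˡ (2 + k) s deg)) ⟩
      k * sumFin (2 + k) (λ p → sumFin s (φ p)) + s * sumFin (2 + k) deg
        ≡⟨ cong₂ (λ a b → k * a + s * b) φ-total
                 (sym (sumPairs-double (2 + k) Y Y-sym Y-diag)) ⟩
      k * vertexCount c + s * (2 * sumPairs (2 + k) Y)
        ≡⟨ cong (λ x → k * vertexCount c + s * (2 * x)) sumPairs-Y ⟩
      k * vertexCount c + s * (2 * pairCount c) ∎
      where
      open ≡-Reasoning
      deg : Fin (2 + k) → ℕ
      deg p = sumFin (2 + k) (Y p)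
      φ-total : sumFin (2 + k) (λ p → sumFin s (φ p)) ≡ vertexCount c
      φ-total = trans (cong (vertexCount c +_) (trans (sumFin-cong (suc k) (λ _ → sumFin-zero s)) (sumFin-zero (suc k))))
                      (+-identityʳ (vertexCount c))

  edgeSum-colouring : (T : KrTiling graph (suc k)) (c : Fin (suc q₁)) →
    edgeSum T (λ u v → δ (col colouring u v) c) + m T * pairCount c ≡ k * vertexCount c + s * (2 * pairCount c)
  edgeSum-colouring T c = begin
    edgeSum T g + m T * pairCount c
      ≡⟨ cong (λ x → edgeSum T g + m T * x) (sumPairs-Y c) ⟨
    edgeSum T g + m T * sumPairs (2 + k) (Y c)
      ≡⟨ edgeSum-partite part adj⇒part≢ (Y c) (Y-sym c) (Y-diag c) (λ v → φ c (part v) (slot v)) g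
                         (λ {u} {v} e → partColour-split c (part u) (slot u) (part v) (slot v) (adj⇒part≢ e)) T ⟩
    sumFin ((2 + k) * s) (λ v → k * φ c (part v) (slot v) + sumFin (2 + k) (Y c (part v)))
      ≡⟨ weight-sum c ⟩
    k * vertexCount c + s * (2 * pairCount c) ∎
    where
    open ≡-Reasoning
    g : Fin ((2 + k) * s) → Fin ((2 + k) * s) → ℕ
    g u v = δ (col colouring u v) c

module Construction (k q₁ a b t : ℕ) (E≡ : choose2 (2 + k) ≡ a * suc q₁ + b) (b<q : b < suc q₁)
                    (b≡0⊎q≤r+b : b ≡ 0 ⊎ 2 + k + b ≥ suc q₁) where

  r q E : ℕ
  r = 2 + k
  q = suc q₁
  E = choose2 r

  pairColour : Fin r → Fin r → Fin q
  pairColour i j = pairIndex i j mod q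

  pairColour-sym : ∀ i j → pairColour i j ≡ pairColour j i
  pairColour-sym i j = cong (_mod q) (pairIndex-sym i j)

  pairClass : Fin q → ℕ
  pairClass = residueCount q E

  pairClass-bound : ∀ c → q * pairClass c ≤ E + r
  pairClass-bound c = begin
    q * pairClass c                   ≡⟨ cong (q *_) (trans (cong (λ L → residueCount q L c) E≡) (residueCount-period q a b c)) ⟩
    q * (a + residueCount q b c)      ≡⟨ *-distribˡ-+ q a (residueCount q b c) ⟩
    q * a + q * residueCount q b c    ≤⟨ +-monoʳ-≤ (q * a) remainder-bound ⟩
    q * a + (b + r)                   ≡⟨ regroup q a b r ⟩
    a * q + b + r                     ≡⟨ cong (_+ r) E≡ ⟨
    E + r                             ∎
    where
    open ≤-Reasoning
    at-most-once : 2 + k + b ≥ q → q * residueCount q b c ≤ b + r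
    at-most-once q≤r+b = ≤-trans (*-monoʳ-≤ q (residueCount-≤1 q c (<⇒≤ b<q)))
      (≤-trans (≤-reflexive (*-identityʳ q)) (≤-trans q≤r+b (≤-reflexive (+-comm r b))))
    remainder-bound : q * residueCount q b c ≤ b + r
    remainder-bound = [ (λ { refl → ≤-trans (≤-reflexive (*-zeroʳ q)) z≤n }) , at-most-once ]′ b≡0⊎q≤r+b
    regroup : ∀ q a b r → q * a + (b + r) ≡ a * q + b + r
    regroup = solve-∀

  -- The truncated subtraction is exact by pairClass-bound.
  deficit : Fin q → ℕ
  deficit c = E + r ∸ q * pairClass c

  deficit+pairClass : ∀ c → deficit c + q * pairClass c ≡ E + r
  deficit+pairClass c = m∸n+n≡m (pairClass-bound c)

  vertexClass : Fin q → ℕ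
  vertexClass c = t * deficit c

  s : ℕ
  s = sumFin q vertexClass

  open MultipartiteColouring (suc k) q₁ s pairColour pairColour-sym (blockOf vertexClass) public

  n : ℕ
  n = suc r * s

  sumFin-deficit : sumFin q deficit ≡ r * q
  sumFin-deficit = +-cancelʳ-≡ (q * E) _ _ (begin
    sumFin q deficit + q * E                                   ≡⟨ cong (λ x → sumFin q deficit + q * x) (sumFin-residueCount q E) ⟨
    sumFin q deficit + q * sumFin q pairClass                  ≡⟨ cong (sumFin q deficit +_) (sumFin-*ˡ q q pairClass) ⟨
    sumFin q deficit + sumFin q (λ c → q * pairClass c)        ≡⟨ sumFin-+ q deficit (λ c → q * pairClass c) ⟨
    sumFin q (λ c → deficit c + q * pairClass c)               ≡⟨ sumFin-cong q deficit+pairClass ⟩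
    sumFin q (λ _ → E + r)                                     ≡⟨ sumFin-const q (E + r) ⟩
    q * (E + r)                                                ≡⟨ regroup q E r ⟩
    r * q + q * E                                              ∎)
    where
    open ≡-Reasoning
    regroup : ∀ q E r → q * (E + r) ≡ r * q + q * E
    regroup = solve-∀

  s≡ : s ≡ t * (r * q)
  s≡ = trans (sumFin-*ˡ q t deficit) (cong (t *_) sumFin-deficit)

  t≤n : t ≤ n
  t≤n = begin
    t              ≤⟨ m≤m*n t (r * q) ⟩
    t * (r * q)    ≡⟨ s≡ ⟨
    s              ≤⟨ m≤n*m s (suc r) ⟩
    n              ∎
    where open ≤-Reasoning

  n≡ : n ≡ suc r * t * q * r
  n≡ = trans (cong (suc r *_) s≡) (regroup r t q)
    where
    regroup : ∀ r t q → suc r * (t * (r * q)) ≡ suc r * t * q * r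
    regroup = solve-∀

  copyCount : (T : KrTiling graph r) → m T ≡ suc r * t * q
  copyCount T = *-cancelʳ-≡ (m T) (suc r * t * q) r (trans (tiling-size T) n≡)

  colourCount-balanced : (T : KrTiling graph r) (c : Fin q) → colourCount colouring T c ≡ suc k * t * (E + r)
  colourCount-balanced T c = +-cancelʳ-≡ (m T * pairCount c) _ _ (begin
    colourCount colouring T c + m T * pairCount c
      ≡⟨ cong (_+ m T * pairCount c) (colourCount≡edgeSum colouring T c) ⟩
    edgeSum T (λ u v → δ (col colouring u v) c) + m T * pairCount c
      ≡⟨ edgeSum-colouring T c ⟩
    suc k * vertexCount c + s * (2 * pairCount c)
      ≡⟨ cong₂ (λ x y → suc k * x + y * (2 * pairCount c)) (blockOf-count q vertexClass c) s≡ ⟩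
    suc k * (t * deficit c) + t * (r * q) * (2 * pairCount c)
      ≡⟨ regroup k t (deficit c) q (pairCount c) ⟩
    suc k * t * (deficit c + q * pairCount c) + suc r * t * q * pairCount c
      ≡⟨ cong₂ (λ x y → suc k * t * x + y * pairCount c) (trans (cong (λ x → deficit c + q * x) pairCount≡) (deficit+pairClass c))
               (sym (copyCount T)) ⟩
    suc k * t * (E + r) + m T * pairCount c ∎)
    where
    open ≡-Reasoning
    pairCount≡ : pairCount c ≡ pairClass c
    pairCount≡ = sumPairs-pairIndex r (λ e → δ (e mod q) c)
    regroup : ∀ k t D q P → suc k * (t * D) + t * ((2 + k) * q) * (2 * P) ≡ suc k * t * (D + q * P) + (3 + k) * t * q * P
    regroup = solve-∀

  discrepancy≡0 : (T : KrTiling graph r) → discrepancy colouring T ≡ ℤ.0ℤ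
  discrepancy≡0 T = i≡j⇒i-j≡0 (cong ℤ.+_ (begin
    maxFin q (λ c → q * colourCount colouring T c)  ≡⟨ maxFin-const q₁ (λ c → cong (q *_) (colourCount-balanced T c)) ⟩
    q * (suc k * t * (E + r))                       ≡⟨ regroup q k t E ⟩
    q * t * (suc k * E + r * suc k)                 ≡⟨ cong (λ x → q * t * (suc k * E + x)) (choose2-double (suc k)) ⟨
    q * t * (suc k * E + 2 * E)                     ≡⟨ regroup′ q k t E ⟩
    suc r * t * q * E                               ≡⟨ cong (_* E) (copyCount T) ⟨
    m T * E                                         ≡⟨ eT≡copies*choose2 T ⟨
    eT T                                            ∎))
    where
    open ≡-Reasoning
    regroup : ∀ q k t E → q * (suc k * t * (E + (2 + k))) ≡ q * t * (suc k * E + (2 + k) * suc k)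
    regroup = solve-∀
    regroup′ : ∀ q k t E → q * t * (suc k * E + 2 * E) ≡ (3 + k) * t * q * E
    regroup′ = solve-∀

open import Data.Integer using (+_)

-- The construction only needs r ≥ 2 and q ≥ 1.
lemma2p6 : (r q a b : ℕ) → 3 ≤ r → 2 ≤ q → q ≤ r C 2 →
    r C 2 ≡ a * q + b → b < q → (b ≡ 0 ⊎ r + b ≥ q) →
    ∀ (N : ℕ) → ∃ λ (n : ℕ) → N ≤ n × r ∣ n ×
      Σ (Graph n) (λ G → ∃ λ (d : ℕ) → MinDegree G d × d * (r + 1) ≡ r * n ×
        Σ (EdgeColouring G q) (λ f → (T : KrTiling G r) → discrepancy f T ≡ + 0))
lemma2p6 .(3 + k) .(suc q₁) a b (s≤s (s≤s (s≤s {n = k} _))) (s≤s {n = q₁} _) _ r-C-2≡ b<q b≡0⊎q≤r+b N =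
  n , <⇒≤ t≤n , divides (suc r * suc N * q) n≡ ,
  graph , r * s , regular⇒MinDegree {G = graph} (degree-completeMultipartite r s) (fromℕ< t≤n) , degree-ratio ,
  colouring , discrepancy≡0
  where
  open Construction (suc k) q₁ a b (suc N) (trans (choose2≡C2 (3 + k)) r-C-2≡) b<q b≡0⊎q≤r+b
  degree-ratio : r * s * (r + 1) ≡ r * n
  degree-ratio = regroup r s
    where
    regroup : ∀ r s → r * s * (r + 1) ≡ r * (suc r * s)
    regroup = solve-∀
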